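{- For each integer $m\ge 1$ let $C_m=\det C^{(m)}$, where $C^{(m)}$ is the $m\times m$ matrix with entries $C^{(m)}_{ij}=1$ if $-2\le j-i\le 1$ and $0$ otherwise. Let $a\in\mathbb{R}$ and let $n\ge 6$ be an integer. Let $T^{(n)}$ be the $n\times n$ matrix defined as follows: the first row has $T^{(n)}_{11}=T^{(n)}_{12}=1$, $T^{(n)}_{1n}=a$ and all other entries $0$; rows $i=2,\dots,n-1$ have $T^{(n)}_{ij}=1$ if $-2\le j-i\le 1$ and $0$ otherwise; the last row has $T^{(n)}_{n,n-1}=T^{(n)}_{nn}=1$ and all other entries $0$. Let $T_n=\det T^{(n)}$. Then $$T_n = C_{n-2}\bigl(1+a(-1)^{n+1}\bigr) - 2C_{n-3} + 2C_{n-4} - C_{n-5}.$$ -}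

module Defs where

open import Level using (Level)
open import Algebra.Bundles using (CommutativeRing)
open import Data.Nat using (ℕ; zero; suc; _≤_; _≤?_; _∸_) renaming (_+_ to _+ℕ_)
open import Data.Nat.Properties using (_≟_)
open import Data.Fin using (Fin; toℕ; punchIn)
open import Relation.Nullary using (Dec; yes; no)

module Det {c ℓ : Level} (R : CommutativeRing c ℓ) where
  open CommutativeRing R

  sgn : ℕ → Carrier → Carrier
  sgn zero x = x
  sgn (suc k) x = - sgn k x

  ∑ : (n : ℕ) → (Fin n → Carrier) → Carrier
  ∑ zero f = 0#
  ∑ (suc n) f = f Fin.zero + ∑ n (λ j → f (Fin.suc j))

  -- determinant, by Laplace expansion along the first row (0-based indices)
  det : (n : ℕ) → (Fin n → Fin n → Carrier) → Carrier
  det zero M = 1#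
  det (suc n) M =
    ∑ (suc n) (λ j → sgn (toℕ j) (M Fin.zero j * det n (λ r k → M (Fin.suc r) (punchIn j k))))

  ind : {P : Set} → Dec P → Carrier
  ind (yes _) = 1#
  ind (no _) = 0#

  -- band entry: 1 iff -2 ≤ j - i ≤ 1  (i.e. i ≤ j + 2 and j ≤ i + 1)
  band : ℕ → ℕ → Carrier
  band i j with i ≤? j +ℕ 2 | j ≤? i +ℕ 1
  ... | yes _ | yes _ = 1#
  ... | _ | _ = 0#

  Cmat : (m : ℕ) → Fin m → Fin m → Carrier
  Cmat m i j = band (toℕ i) (toℕ j)

  C : ℕ → Carrier
  C m = det m (Cmat m)

  -- entry (i,j) of T^(n) (0-based indices i, j < n)
  Tentry : (n : ℕ) → Carrier → ℕ → ℕ → Carrier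
  Tentry n a zero j with j ≟ 0 | j ≟ 1 | j ≟ n ∸ 1
  ... | yes _ | _ | _ = 1#
  ... | no _ | yes _ | _ = 1#
  ... | no _ | no _ | yes _ = a
  ... | no _ | no _ | no _ = 0#
  Tentry n a (suc i) j with suc i ≟ n ∸ 1
  ... | no _ = band (suc i) j
  ... | yes _ with j ≟ n ∸ 2 | j ≟ n ∸ 1
  ...   | yes _ | _ = 1#
  ...   | no _ | yes _ = 1#
  ...   | no _ | no _ = 0#

  Tmat : (n : ℕ) → Carrier → Fin n → Fin n → Carrier
  Tmat n a i j = Tentry n a (toℕ i) (toℕ j)

  T : ℕ → Carrier → Carrier
  T n a = det n (Tmat n a)

module Submission where

-- Matrices are handled as functions ℕ → ℕ → R of which only a leading square
-- block is used, so that deleting rows and columns is a reindexing.  Everything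
-- is obtained from the Laplace expansion along the first row (the definition of
-- det), exploiting that the matrices involved are sparse:
--
--  * A band-type matrix A of order 3+m expands into its three leading corner
--    minors: D(A) = D(A') - D(A'') + γ D(A''') (CornerExpansion).  This holds for
--    the band matrices C^(m) (γ = 1) and for the two families of minors E_N, K_N
--    of T^(N+1) obtained by deleting the first row and the first resp. last column.
--  * In a coherent family (corner minors of a member are the smaller members)
--    such an expansion with γ = 1 says that x_{m+3} + x_{m+1} = x_{m+2} + x_m.
--    This third-order recurrence determines a sequence from three values, so
--    comparing initial values gives E_{m+2} = C_{m+1} - C_m and K_{m+1} = C_m.
--  * Expanding T^(n) along its first row (entries 1, 1 and a) gives
--    T_n = E_{n-1} - (E_{n-2} - E_{n-3}) + (-1)^(n+1) a K_{n-1}, which is the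
--    claimed formula after substituting C for E and K.

open import Defs
open import Level using (Level)
open import Algebra.Bundles using (CommutativeRing)
open import Data.Nat using (ℕ; zero; suc; pred; _≤_; _<_; z≤n; s≤s; _∸_; _≤?_) renaming (_+_ to _+ℕ_)
open import Data.Nat.Properties
  using (_≟_; suc-injective; ≤-pred; ≤-trans; ≤-reflexive; n≤1+n; n<1+n; <-irrefl; <⇒≱; ≤∧≢⇒<; m+1+n≰m; pred[m∸n]≡m∸[1+n])
open import Data.Fin as Fin using (Fin; toℕ; punchIn)
open import Data.Fin.Properties using (toℕ<n)
open import Relation.Binary.PropositionalEquality as Eq using (_≡_; _≢_)
open import Relation.Nullary using (yes; no)
open import Data.Empty using (⊥; ⊥-elim)

module BandDeterminants {c ℓ : Level} (R : CommutativeRing c ℓ) where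
  open CommutativeRing R hiding (zero)
  open Det R
  open import Algebra.Properties.Ring ring using (-0#≈0#; -‿distribˡ-*; -‿involutive; -‿+-comm; +-cancelʳ)
  open import Algebra.Properties.CommutativeSemigroup +-commutativeSemigroup using (interchange)
  open import Algebra.Solver.CommutativeMonoid +-commutativeMonoid using (solve; _⊜_; _⊕_)
  open import Relation.Binary.Reasoning.Setoid setoid

  scale-one : ∀ {u} x → u ≈ 1# → u * x ≈ x
  scale-one x u≈1 = trans (*-congʳ u≈1) (*-identityˡ x)

  neg-+ : ∀ x y → - (x + y) ≈ - x + - y
  neg-+ x y = sym (-‿+-comm x y)

  neg-sub : ∀ x y → - (x + - y) ≈ - x + y
  neg-sub x y = trans (neg-+ x (- y)) (+-congˡ (-‿involutive y))

  sub-sub : ∀ x y z → x + - (y + - z) ≈ x + - y + z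
  sub-sub x y z = trans (+-congˡ (neg-sub y z)) (sym (+-assoc x (- y) z))

  ∑-cong : ∀ n {f g : Fin n → Carrier} → (∀ j → f j ≈ g j) → ∑ n f ≈ ∑ n g
  ∑-cong zero    f≈g = refl
  ∑-cong (suc n) f≈g = +-cong (f≈g Fin.zero) (∑-cong n (λ j → f≈g (Fin.suc j)))

  sgn-cong : ∀ k {x y} → x ≈ y → sgn k x ≈ sgn k y
  sgn-cong zero    x≈y = x≈y
  sgn-cong (suc k) x≈y = -‿cong (sgn-cong k x≈y)

  sgn-zero : ∀ k → sgn k 0# ≈ 0#
  sgn-zero zero    = refl
  sgn-zero (suc k) = trans (-‿cong (sgn-zero k)) -0#≈0#

  sgn-*ˡ : ∀ k x y → sgn k (x * y) ≈ sgn k x * y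
  sgn-*ˡ zero    x y = refl
  sgn-*ˡ (suc k) x y = trans (-‿cong (sgn-*ˡ k x y)) (-‿distribˡ-* (sgn k x) y)

  sgn-2+ : ∀ k x → sgn (2 +ℕ k) x ≈ sgn k x
  sgn-2+ k x = -‿involutive (sgn k x)

  sgn-vanishesˡ : ∀ k {x} y → x ≈ 0# → sgn k (x * y) ≈ 0#
  sgn-vanishesˡ k y x≈0 = trans (sgn-cong k (trans (*-congʳ x≈0) (zeroˡ y))) (sgn-zero k)

  sgn-vanishesʳ : ∀ k x {y} → y ≈ 0# → sgn k (x * y) ≈ 0#
  sgn-vanishesʳ k x y≈0 = trans (sgn-cong k (trans (*-congˡ y≈0) (zeroʳ x))) (sgn-zero k)

  det-cong : ∀ n {M N : Fin n → Fin n → Carrier} → (∀ i j → M i j ≈ N i j) → det n M ≈ det n N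
  det-cong zero    M≈N = refl
  det-cong (suc n) M≈N = ∑-cong (suc n) (λ j → sgn-cong (toℕ j)
    (*-cong (M≈N Fin.zero j) (det-cong n (λ r k → M≈N (Fin.suc r) (punchIn j k)))))

  Mat : Set c
  Mat = ℕ → ℕ → Carrier

  D : ℕ → Mat → Carrier
  D n A = det n (λ i j → A (toℕ i) (toℕ j))

  -- punchIn on indices: the k-th column that remains after deleting column j
  punchInℕ : ℕ → ℕ → ℕ
  punchInℕ zero    k       = suc k
  punchInℕ (suc j) zero    = zero
  punchInℕ (suc j) (suc k) = suc (punchInℕ j k)

  toℕ-punchIn : ∀ {n} (j : Fin (suc n)) (k : Fin n) → toℕ (punchIn j k) ≡ punchInℕ (toℕ j) (toℕ k)
  toℕ-punchIn Fin.zero    k           = Eq.refl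
  toℕ-punchIn (Fin.suc j) Fin.zero    = Eq.refl
  toℕ-punchIn (Fin.suc j) (Fin.suc k) = Eq.cong suc (toℕ-punchIn j k)

  punchInℕ-below : ∀ {j k} → k < j → punchInℕ j k ≡ k
  punchInℕ-below {suc j} {zero}  _           = Eq.refl
  punchInℕ-below {suc j} {suc k} (s≤s k<j) = Eq.cong suc (punchInℕ-below k<j)

  minor : Mat → ℕ → Mat
  minor A j r k = A (suc r) (punchInℕ j k)

  shift : Mat → Mat
  shift A r k = A (suc r) (suc k)

  sumTo : ℕ → (ℕ → Carrier) → Carrier
  sumTo zero    g = 0#
  sumTo (suc n) g = g 0 + sumTo n (λ j → g (suc j))

  ∑-sumTo : ∀ n (g : ℕ → Carrier) → ∑ n (λ j → g (toℕ j)) ≡ sumTo n g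
  ∑-sumTo zero    g = Eq.refl
  ∑-sumTo (suc n) g = Eq.cong (g 0 +_) (∑-sumTo n (λ j → g (suc j)))

  D-cong : ∀ n {A B : Mat} → (∀ i j → i < n → j < n → A i j ≈ B i j) → D n A ≈ D n B
  D-cong n A≈B = det-cong n (λ i j → A≈B (toℕ i) (toℕ j) (toℕ<n i) (toℕ<n j))

  laplace : ∀ n A → D (suc n) A ≈ sumTo (suc n) (λ j → sgn j (A 0 j * D n (minor A j)))
  laplace n A = trans
    (∑-cong (suc n) {g = λ j → sgn (toℕ j) (A 0 (toℕ j) * D n (minor A (toℕ j)))} (λ j → sgn-cong (toℕ j) (*-congˡ
      (det-cong n (λ r k → reflexive (Eq.cong (A (suc (toℕ r))) (toℕ-punchIn j k)))))))
    (reflexive (∑-sumTo (suc n) (λ j → sgn j (A 0 j * D n (minor A j)))))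

  sumTo-vanishes : ∀ n g → (∀ j → j < n → g j ≈ 0#) → sumTo n g ≈ 0#
  sumTo-vanishes zero    g g≈0 = refl
  sumTo-vanishes (suc n) g g≈0 =
    trans (+-cong (g≈0 0 (s≤s z≤n)) (sumTo-vanishes n _ (λ j j<n → g≈0 (suc j) (s≤s j<n)))) (+-identityʳ 0#)

  sumTo-single : ∀ n p g → p < n → (∀ j → j < n → j ≢ p → g j ≈ 0#) → sumTo n g ≈ g p
  sumTo-single (suc n) zero g _ off =
    trans (+-congˡ (sumTo-vanishes n _ (λ j j<n → off (suc j) (s≤s j<n) (λ ())))) (+-identityʳ _)
  sumTo-single (suc n) (suc p) g (s≤s p<n) off =
    trans (+-cong (off 0 (s≤s z≤n) (λ ()))
                  (sumTo-single n p _ p<n (λ j j<n j≢p → off (suc j) (s≤s j<n) (λ e → j≢p (suc-injective e)))))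
          (+-identityˡ _)

  det-zero-column : ∀ n (A : Mat) → (∀ r → r < suc n → A r 0 ≈ 0#) → D (suc n) A ≈ 0#
  det-zero-column zero A col = trans (laplace 0 A) (trans (+-identityʳ _) (sgn-vanishesˡ 0 _ (col 0 (s≤s z≤n))))
  det-zero-column (suc n) A col = trans (laplace (suc n) A) (sumTo-vanishes (2 +ℕ n) _ term)
    where
    term : ∀ j → j < 2 +ℕ n → sgn j (A 0 j * D (suc n) (minor A j)) ≈ 0#
    term zero    _ = sgn-vanishesˡ 0 _ (col 0 (s≤s z≤n))
    term (suc j) _ = sgn-vanishesʳ (suc j) _ (det-zero-column n (minor A (suc j)) (λ r r<n → col (suc r) (s≤s r<n)))

  det-first-column : ∀ n (A : Mat) → (∀ r → r < n → A (suc r) 0 ≈ 0#) → D (suc n) A ≈ A 0 0 * D n (shift A)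
  det-first-column zero A col = trans (laplace 0 A) (+-identityʳ _)
  det-first-column (suc n) A col = trans (laplace (suc n) A) (trans (+-congˡ (sumTo-vanishes (suc n) _ term)) (+-identityʳ _))
    where
    term : ∀ j → j < suc n → sgn (suc j) (A 0 (suc j) * D (suc n) (minor A (suc j))) ≈ 0#
    term j _ = sgn-vanishesʳ (suc j) _ (det-zero-column n (minor A (suc j)) col)

  det-two-entry-row : ∀ n (A : Mat) → (∀ j → j < n → A 0 (2 +ℕ j) ≈ 0#) →
    D (2 +ℕ n) A ≈ A 0 0 * D (suc n) (shift A) + - (A 0 1 * D (suc n) (minor A 1))
  det-two-entry-row n A row = trans (laplace (suc n) A) (+-congˡ (trans (+-congˡ (sumTo-vanishes n _ term)) (+-identityʳ _)))
    where
    term : ∀ j → j < n → sgn (2 +ℕ j) (A 0 (2 +ℕ j) * D (suc n) (minor A (2 +ℕ j))) ≈ 0#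
    term j j<n = sgn-vanishesˡ (2 +ℕ j) _ (row j j<n)

  det-corner-row : ∀ n (A : Mat) → (∀ j → j < n → A 0 (2 +ℕ j) ≈ 0#) →
    D (3 +ℕ n) A ≈ A 0 0 * D (2 +ℕ n) (shift A) + - (A 0 1 * D (2 +ℕ n) (minor A 1))
                   + sgn (2 +ℕ n) (A 0 (2 +ℕ n) * D (2 +ℕ n) (λ r k → A (suc r) k))
  det-corner-row n A row =
    trans (laplace (2 +ℕ n) A)
          (trans (+-congˡ (+-congˡ (trans (sumTo-single (suc n) n _ (n<1+n n) off) last))) (sym (+-assoc _ _ _)))
    where
    off : ∀ j → j < suc n → j ≢ n → sgn (2 +ℕ j) (A 0 (2 +ℕ j) * D (2 +ℕ n) (minor A (2 +ℕ j))) ≈ 0#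
    off j j<1+n j≢n = sgn-vanishesˡ (2 +ℕ j) _ (row j (≤∧≢⇒< (≤-pred j<1+n) j≢n))
    -- inside the block, deleting the last column changes no column index
    last : sgn (2 +ℕ n) (A 0 (2 +ℕ n) * D (2 +ℕ n) (minor A (2 +ℕ n)))
         ≈ sgn (2 +ℕ n) (A 0 (2 +ℕ n) * D (2 +ℕ n) (λ r k → A (suc r) k))
    last = sgn-cong (2 +ℕ n) (*-congˡ (D-cong (2 +ℕ n) (λ r k _ k<2+n →
             reflexive (Eq.cong (A (suc r)) (punchInℕ-below k<2+n)))))

  det-1 : ∀ A → D 1 A ≈ A 0 0
  det-1 A = trans (det-first-column 0 A (λ _ ())) (*-identityʳ _)

  det-2 : ∀ A → D 2 A ≈ A 0 0 * A 1 1 + - (A 0 1 * A 1 0)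
  det-2 A = trans (det-two-entry-row 0 A (λ _ ()))
                  (+-cong (*-congˡ (det-1 (shift A))) (-‿cong (*-congˡ (det-1 (minor A 1)))))

  CornerExpansion : ℕ → Carrier → Mat → Set ℓ
  CornerExpansion m γ A =
    D (3 +ℕ m) A ≈ D (2 +ℕ m) (shift A) + - D (1 +ℕ m) (shift (shift A)) + γ * D m (shift (shift (shift A)))

  -- a matrix shaped like the band matrix in its first two rows and its first column has a
  -- corner expansion with γ = A 2 0 (expand along row 0, then row 1, then column 0)
  band-expansion : ∀ m (A : Mat) → A 0 0 ≈ 1# → A 0 1 ≈ 1# → A 1 0 ≈ 1# → A 1 2 ≈ 1# →
    (∀ j → A 0 (2 +ℕ j) ≈ 0#) → (∀ j → A 1 (3 +ℕ j) ≈ 0#) → (∀ r → A (3 +ℕ r) 0 ≈ 0#) →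
    CornerExpansion m (A 2 0) A
  band-expansion m A a₀₀ a₀₁ a₁₀ a₁₂ row₀ row₁ col₀ =
    trans (det-two-entry-row (suc m) A (λ j _ → row₀ j))
          (trans (+-cong (scale-one _ a₀₀) (-‿cong (trans (scale-one _ a₀₁) second-row))) (sub-sub _ _ _))
    where
    second-row : D (2 +ℕ m) (minor A 1) ≈ D (suc m) (shift (shift A)) + - (A 2 0 * D m (shift (shift (shift A))))
    second-row = trans (det-two-entry-row m (minor A 1) (λ j _ → row₁ j))
      (+-cong (scale-one _ a₁₀) (-‿cong (trans (scale-one _ a₁₂) (det-first-column m (minor (minor A 1) 1) (λ r _ → col₀ r)))))

  -- a matrix shaped like the band matrix shifted one column to the right has a corner
  -- expansion with γ = A 2 1 (expand along row 0, then along first columns)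
  shifted-band-expansion : ∀ m (A : Mat) → A 0 0 ≈ 1# → A 0 1 ≈ 1# → A 0 2 ≈ 1# → A 1 0 ≈ 1# →
    (∀ j → A 0 (3 +ℕ j) ≈ 0#) → (∀ r → A (2 +ℕ r) 0 ≈ 0#) → (∀ r → A (3 +ℕ r) 1 ≈ 0#) →
    CornerExpansion m (A 2 1) A
  shifted-band-expansion m A a₀₀ a₀₁ a₀₂ a₁₀ row₀ col₀ col₁ =
    trans (laplace (2 +ℕ m) A)
          (trans (+-cong (scale-one _ a₀₀) (+-cong (-‿cong second-term) (+-cong (-‿cong (-‿cong third-term)) (sumTo-vanishes m _ rest))))
                 (trans (+-congˡ (+-congˡ (trans (+-identityʳ _) (-‿involutive _)))) (sym (+-assoc _ _ _))))
    where
    second-term : A 0 1 * D (2 +ℕ m) (minor A 1) ≈ D (suc m) (shift (shift A))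
    second-term = trans (scale-one _ a₀₁) (trans (det-first-column (suc m) (minor A 1) (λ r _ → col₀ r)) (scale-one _ a₁₀))
    third-term : A 0 2 * D (2 +ℕ m) (minor A 2) ≈ A 2 1 * D m (shift (shift (shift A)))
    third-term = trans (scale-one _ a₀₂) (trans (det-first-column (suc m) (minor A 2) (λ r _ → col₀ r))
                   (trans (scale-one _ a₁₀) (det-first-column m (shift (minor A 2)) (λ r _ → col₁ r))))
    rest : ∀ j → j < m → sgn (3 +ℕ j) (A 0 (3 +ℕ j) * D (2 +ℕ m) (minor A (3 +ℕ j))) ≈ 0#
    rest j _ = sgn-vanishesˡ (3 +ℕ j) _ (row₀ j)

  Recurrent : (ℕ → Carrier) → Set ℓ
  Recurrent x = ∀ m → x (3 +ℕ m) + x (1 +ℕ m) ≈ x (2 +ℕ m) + x m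

  recurrent-+ : ∀ {x y} → Recurrent x → Recurrent y → Recurrent (λ m → x m + y m)
  recurrent-+ rx ry m = trans (interchange _ _ _ _) (trans (+-cong (rx m) (ry m)) (interchange _ _ _ _))

  recurrent-neg : ∀ {x} → Recurrent x → Recurrent (λ m → - x m)
  recurrent-neg rx m = trans (-‿+-comm _ _) (trans (-‿cong (rx m)) (neg-+ _ _))

  recurrent-unique : ∀ {x y} → Recurrent x → Recurrent y → x 0 ≈ y 0 → x 1 ≈ y 1 → x 2 ≈ y 2 → ∀ m → x m ≈ y m
  recurrent-unique rx ry e₀ e₁ e₂ zero             = e₀
  recurrent-unique rx ry e₀ e₁ e₂ (suc zero)       = e₁
  recurrent-unique rx ry e₀ e₁ e₂ (suc (suc zero)) = e₂
  recurrent-unique {x} {y} rx ry e₀ e₁ e₂ (suc (suc (suc m))) = +-cancelʳ (y (suc m)) _ _ (begin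
    x (3 +ℕ m) + y (1 +ℕ m)  ≈⟨ +-congˡ (sym (recurrent-unique rx ry e₀ e₁ e₂ (suc m))) ⟩
    x (3 +ℕ m) + x (1 +ℕ m)  ≈⟨ rx m ⟩
    x (2 +ℕ m) + x m         ≈⟨ +-cong (recurrent-unique rx ry e₀ e₁ e₂ (suc (suc m))) (recurrent-unique rx ry e₀ e₁ e₂ m) ⟩
    y (2 +ℕ m) + y m         ≈⟨ ry m ⟨
    y (3 +ℕ m) + y (1 +ℕ m)  ∎)

  Coherent : (ℕ → Mat) → Set ℓ
  Coherent G = ∀ N r k → G (suc N) (suc r) (suc k) ≈ G N r k

  coherent-corner : ∀ {G} → Coherent G → ∀ i N r k → G (i +ℕ N) (i +ℕ r) (i +ℕ k) ≈ G N r k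
  coherent-corner coh zero    N r k = refl
  coherent-corner coh (suc i) N r k = trans (coh (i +ℕ N) (i +ℕ r) (i +ℕ k)) (coherent-corner coh i N r k)

  coherent-minor : ∀ {G} → Coherent G → ∀ i N n → D n (λ r k → G (i +ℕ N) (i +ℕ r) (i +ℕ k)) ≈ D n (G N)
  coherent-minor coh i N n = D-cong n (λ r k _ _ → coherent-corner coh i N r k)

  coherent-expansion : ∀ {G} → Coherent G → ∀ m γ → CornerExpansion m γ (G (3 +ℕ m)) →
    D (3 +ℕ m) (G (3 +ℕ m)) ≈ D (2 +ℕ m) (G (2 +ℕ m)) + - D (1 +ℕ m) (G (1 +ℕ m)) + γ * D m (G m)
  coherent-expansion coh m γ expansion = trans expansion
    (+-cong (+-cong (coherent-minor coh 1 (2 +ℕ m) (2 +ℕ m)) (-‿cong (coherent-minor coh 2 (1 +ℕ m) (1 +ℕ m))))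
            (*-congˡ (coherent-minor coh 3 m m)))

  coherent-step : ∀ {G} → Coherent G → ∀ m → CornerExpansion m 1# (G (3 +ℕ m)) →
    D (3 +ℕ m) (G (3 +ℕ m)) + D (1 +ℕ m) (G (1 +ℕ m)) ≈ D (2 +ℕ m) (G (2 +ℕ m)) + D m (G m)
  coherent-step {G} coh m expansion = begin
    x₃ + x₁                 ≈⟨ +-congʳ (coherent-expansion coh m 1# expansion) ⟩
    x₂ + - x₁ + 1# * x₀ + x₁ ≈⟨ +-congʳ (+-congˡ (*-identityˡ x₀)) ⟩
    x₂ + - x₁ + x₀ + x₁      ≈⟨ solve 4 (λ a b c d → ((a ⊕ b) ⊕ c) ⊕ d ⊜ (a ⊕ c) ⊕ (b ⊕ d)) refl x₂ (- x₁) x₀ x₁ ⟩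
    x₂ + x₀ + (- x₁ + x₁)    ≈⟨ +-congˡ (-‿inverseˡ x₁) ⟩
    x₂ + x₀ + 0#             ≈⟨ +-identityʳ _ ⟩
    x₂ + x₀                  ∎
    where
    x₃ x₂ x₁ x₀ : Carrier
    x₃ = D (3 +ℕ m) (G (3 +ℕ m))
    x₂ = D (2 +ℕ m) (G (2 +ℕ m))
    x₁ = D (1 +ℕ m) (G (1 +ℕ m))
    x₀ = D m (G m)

  band-shift : ∀ i j → band (suc i) (suc j) ≡ band i j
  band-shift i j with suc i ≤? suc j +ℕ 2 | i ≤? j +ℕ 2 | suc j ≤? suc i +ℕ 1 | j ≤? i +ℕ 1
  ... | yes _ | yes _ | yes _ | yes _ = Eq.refl
  ... | yes p | no ¬q | _     | _     = ⊥-elim (¬q (≤-pred p))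
  ... | no ¬p | yes q | _     | _     = ⊥-elim (¬p (s≤s q))
  ... | no _  | no _  | _     | _     = Eq.refl
  ... | yes _ | yes _ | yes p | no ¬q = ⊥-elim (¬q (≤-pred p))
  ... | yes _ | yes _ | no ¬p | yes q = ⊥-elim (¬p (s≤s q))
  ... | yes _ | yes _ | no _  | no _  = Eq.refl

  band-below : ∀ i j → j +ℕ 2 < i → band i j ≡ 0#
  band-below i j j+2<i with i ≤? j +ℕ 2 | j ≤? i +ℕ 1
  ... | yes i≤j+2 | yes _ = ⊥-elim (<⇒≱ j+2<i i≤j+2)
  ... | yes _     | no _  = Eq.refl
  ... | no _      | _     = Eq.refl

  band-coherent : Coherent (λ _ → band)
  band-coherent N r k = reflexive (band-shift r k)

  C-expansion : ∀ m → CornerExpansion m 1# band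
  C-expansion m = band-expansion m band refl refl refl refl (λ _ → refl) (λ _ → refl) (λ _ → refl)

  C-recurrent : Recurrent C
  C-recurrent m = coherent-step band-coherent m (C-expansion m)

  C-1 : C 1 ≈ 1#
  C-1 = det-1 band

  C-2 : C 2 ≈ 0#
  C-2 = trans (det-2 band) (-‿inverseʳ _)

  C-3 : C 3 ≈ 0#
  C-3 = trans (coherent-expansion band-coherent 0 1# (C-expansion 0))
              (trans (+-cong (+-cong C-2 (-‿cong C-1)) (*-identityʳ 1#)) (trans (+-congʳ (+-identityˡ _)) (-‿inverseˡ 1#)))

  Tentry-shift : ∀ n a i j → Tentry (suc n) a (suc (suc i)) (suc j) ≡ Tentry n a (suc i) j
  Tentry-shift zero          a i j = band-shift (suc i) j
  Tentry-shift (suc zero)    a i j = band-shift (suc i) j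
  Tentry-shift (suc (suc n)) a i j with suc (suc i) ≟ suc (suc n) | suc i ≟ suc n
  ... | no _  | no _  = band-shift (suc i) j
  ... | yes p | no ¬q = ⊥-elim (¬q (suc-injective p))
  ... | no ¬p | yes q = ⊥-elim (¬p (Eq.cong suc q))
  ... | yes _ | yes _ with suc j ≟ suc n | j ≟ n | suc j ≟ suc (suc n) | j ≟ suc n
  ...   | yes _ | yes _ | _     | _     = Eq.refl
  ...   | yes p | no ¬q | _     | _     = ⊥-elim (¬q (suc-injective p))
  ...   | no ¬p | yes q | _     | _     = ⊥-elim (¬p (Eq.cong suc q))
  ...   | no _  | no _  | yes _ | yes _ = Eq.refl
  ...   | no _  | no _  | yes p | no ¬q = ⊥-elim (¬q (suc-injective p))
  ...   | no _  | no _  | no ¬p | yes q = ⊥-elim (¬p (Eq.cong suc q))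
  ...   | no _  | no _  | no _  | no _  = Eq.refl

  -- the last row 1+i is supported in the columns i and 1+i, which lie right of any j with j+2 < 1+i
  left-of-last-row : ∀ {i j} → j +ℕ 2 < suc i → i ≤ j → ⊥
  left-of-last-row {i} {j} j+2<1+i i≤j = m+1+n≰m j (≤-trans (≤-pred j+2<1+i) i≤j)

  T-below-band : ∀ n a i j → j +ℕ 2 < i → Tentry n a i j ≈ 0#
  T-below-band n a (suc i) j j+2<i with suc i ≟ n ∸ 1
  ... | no _ = reflexive (band-below (suc i) j j+2<i)
  ... | yes last with j ≟ n ∸ 2 | j ≟ n ∸ 1
  ...   | no _  | no _  = refl
  ...   | yes j≡n-2 | _ = ⊥-elim (left-of-last-row j+2<i
          (≤-reflexive (Eq.trans (Eq.trans (Eq.cong pred last) (pred[m∸n]≡m∸[1+n] n 1)) (Eq.sym j≡n-2))))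
  ...   | no _  | yes j≡n-1 = ⊥-elim (left-of-last-row j+2<i
          (≤-trans (n≤1+n i) (≤-reflexive (Eq.trans last (Eq.sym j≡n-1)))))

  collect : ∀ c₄ c₃ c₂ c₁ s → c₄ + - c₃ + - (c₃ + - c₂ + - (c₂ + - c₁)) + s * c₄
                             ≈ c₄ * (1# + s) + - (c₃ + c₃) + (c₂ + c₂) + - c₁
  collect c₄ c₃ c₂ c₁ s = begin
    c₄ + - c₃ + - (c₃ + - c₂ + - (c₂ + - c₁)) + s * c₄
      ≈⟨ +-congʳ (+-congˡ (trans (neg-sub _ _) (+-congʳ (neg-sub c₃ c₂)))) ⟩
    c₄ + - c₃ + (- c₃ + c₂ + (c₂ + - c₁)) + s * c₄
      ≈⟨ solve 5 (λ a b c d p → ((a ⊕ b) ⊕ ((b ⊕ c) ⊕ (c ⊕ d))) ⊕ p ⊜ (((a ⊕ p) ⊕ (b ⊕ b)) ⊕ (c ⊕ c)) ⊕ d)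
               refl c₄ (- c₃) c₂ (- c₁) (s * c₄) ⟩
    c₄ + s * c₄ + (- c₃ + - c₃) + (c₂ + c₂) + - c₁
      ≈⟨ +-congʳ (+-congʳ (+-cong (sym expand) (-‿+-comm c₃ c₃))) ⟩
    c₄ * (1# + s) + - (c₃ + c₃) + (c₂ + c₂) + - c₁ ∎
    where
    expand : c₄ * (1# + s) ≈ c₄ + s * c₄
    expand = trans (distribˡ c₄ 1# s) (+-cong (*-identityʳ c₄) (*-comm c₄ s))

  module CornerMinors (a : Carrier) where

    Em : ℕ → Mat
    Em N r k = Tentry (suc N) a (suc r) (suc k)

    -- T^(N+1) without its first row and last column
    Km : ℕ → Mat
    Km N r k = Tentry (suc N) a (suc r) k

    E K : ℕ → Carrier
    E N = D N (Em N)
    K N = D N (Km N)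

    Em-coherent : Coherent Em
    Em-coherent N r k = reflexive (Tentry-shift (suc N) a r (suc k))

    Km-coherent : Coherent Km
    Km-coherent N r k = reflexive (Tentry-shift (suc N) a r k)

    -- the coefficient Em (3+m) 2 0 is 1, except 0 when m = 0 (it lies in the last row of T^4)
    E-expansion : ∀ m → CornerExpansion m (Em (3 +ℕ m) 2 0) (Em (3 +ℕ m))
    E-expansion m = band-expansion m (Em (3 +ℕ m)) refl refl refl refl (λ _ → refl) (λ _ → refl)
      (λ r → T-below-band (4 +ℕ m) a (4 +ℕ r) 1 (s≤s (s≤s (s≤s (s≤s z≤n)))))

    K-expansion : ∀ m → CornerExpansion m (Km (3 +ℕ m) 2 1) (Km (3 +ℕ m))
    K-expansion m = shifted-band-expansion m (Km (3 +ℕ m)) refl refl refl refl (λ _ → refl)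
      (λ r → T-below-band (4 +ℕ m) a (3 +ℕ r) 0 (s≤s (s≤s (s≤s z≤n))))
      (λ r → T-below-band (4 +ℕ m) a (4 +ℕ r) 1 (s≤s (s≤s (s≤s (s≤s z≤n)))))

    -- from order 4 on the coefficients are 1, giving the recurrence
    E-recurrent : Recurrent (λ N → E (suc N))
    E-recurrent m = coherent-step Em-coherent (suc m) (E-expansion (suc m))

    K-recurrent : Recurrent (λ N → K (suc N))
    K-recurrent m = coherent-step Km-coherent (suc m) (K-expansion (suc m))

    E-1 : E 1 ≈ 1#
    E-1 = det-1 (Em 1)

    E-2 : E 2 ≈ 0#
    E-2 = trans (det-2 (Em 2)) (-‿inverseʳ _)

    E-3 : E 3 ≈ - 1#
    E-3 = trans (coherent-expansion Em-coherent 0 0# (E-expansion 0))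
                (trans (+-cong (+-cong E-2 (-‿cong E-1)) (zeroˡ _)) (trans (+-identityʳ _) (+-identityˡ _)))

    E-4 : E 4 ≈ 0#
    E-4 = trans (coherent-expansion Em-coherent 1 1# (E-expansion 1))
                (trans (+-cong (+-cong E-3 (trans (-‿cong E-2) -0#≈0#)) (trans (*-identityˡ _) E-1))
                       (trans (+-congʳ (+-identityʳ _)) (-‿inverseˡ 1#)))

    K-1 : K 1 ≈ 1#
    K-1 = det-1 (Km 1)

    K-2 : K 2 ≈ 1#
    K-2 = trans (det-2 (Km 2)) (trans (+-cong (*-identityˡ 1#) (trans (-‿cong (zeroʳ 1#)) -0#≈0#)) (+-identityʳ 1#))

    K-3 : K 3 ≈ 0#
    K-3 = trans (coherent-expansion Km-coherent 0 0# (K-expansion 0))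
                (trans (+-cong (+-cong K-2 (-‿cong K-1)) (zeroˡ _)) (trans (+-identityʳ _) (-‿inverseʳ 1#)))

    E-from-C : ∀ m → E (2 +ℕ m) ≈ C (suc m) + - C m
    E-from-C = recurrent-unique {x = λ m → E (2 +ℕ m)} {y = λ m → C (suc m) + - C m}
      (λ m → E-recurrent (suc m))
      (recurrent-+ {x = λ m → C (suc m)} (λ m → C-recurrent (suc m)) (recurrent-neg {x = C} C-recurrent))
      (trans E-2 (sym (trans (+-congʳ C-1) (-‿inverseʳ 1#))))
      (trans E-3 (sym (trans (+-cong C-2 (-‿cong C-1)) (+-identityˡ _))))
      (trans E-4 (sym (trans (+-cong C-3 (-‿cong C-2)) (trans (+-identityˡ _) -0#≈0#))))

    K-from-C : ∀ m → K (suc m) ≈ C m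
    K-from-C = recurrent-unique {x = λ m → K (suc m)} {y = C} K-recurrent C-recurrent
      K-1 (trans K-2 (sym C-1)) (trans K-3 (sym C-2))

    T-first-row-gap : ∀ m j → j < 3 +ℕ m → Tentry (6 +ℕ m) a 0 (2 +ℕ j) ≈ 0#
    T-first-row-gap m j j<3+m with 2 +ℕ j ≟ 5 +ℕ m
    ... | yes 2+j≡5+m = ⊥-elim (<-irrefl (suc-injective (suc-injective 2+j≡5+m)) j<3+m)
    ... | no _        = refl

    T-corner : ∀ m → Tentry (6 +ℕ m) a 0 (5 +ℕ m) ≈ a
    T-corner m with 5 +ℕ m ≟ 5 +ℕ m
    ... | yes _  = refl
    ... | no ¬eq = ⊥-elim (¬eq Eq.refl)

    -- the minor at the entry (0,1) is band-like with its corner minors in the family E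
    T-second-minor : ∀ m → D (5 +ℕ m) (minor (Tentry (6 +ℕ m) a) 1) ≈ E (4 +ℕ m) + - E (3 +ℕ m)
    T-second-minor m =
      trans (band-expansion (2 +ℕ m) (minor (Tentry (6 +ℕ m) a) 1) refl refl refl refl (λ _ → refl) (λ _ → refl)
               (λ r → T-below-band (6 +ℕ m) a (4 +ℕ r) 0 (s≤s (s≤s (s≤s z≤n)))))
            (trans (+-cong (+-cong (coherent-minor Em-coherent 1 (4 +ℕ m) (4 +ℕ m))
                                   (-‿cong (coherent-minor Em-coherent 2 (3 +ℕ m) (3 +ℕ m))))
                           (zeroˡ _))
                   (+-identityʳ _))

    T-formula : ∀ m → let n = 6 +ℕ m in
      T n a ≈ C (n ∸ 2) * (1# + sgn (suc n) a) + - (C (n ∸ 3) + C (n ∸ 3)) + (C (n ∸ 4) + C (n ∸ 4)) + - C (n ∸ 5)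
    T-formula m = begin
      T (6 +ℕ m) a
        ≈⟨ det-corner-row (3 +ℕ m) (Tentry (6 +ℕ m) a) (T-first-row-gap m) ⟩
      1# * E (5 +ℕ m) + - (1# * D (5 +ℕ m) (minor (Tentry (6 +ℕ m) a) 1))
        + sgn (5 +ℕ m) (Tentry (6 +ℕ m) a 0 (5 +ℕ m) * K (5 +ℕ m))
        ≈⟨ +-cong (+-cong (*-identityˡ _) (-‿cong (trans (*-identityˡ _) (T-second-minor m)))) corner-term ⟩
      E (5 +ℕ m) + - (E (4 +ℕ m) + - E (3 +ℕ m)) + sgn (7 +ℕ m) a * C (4 +ℕ m)
        ≈⟨ +-congʳ (+-cong (E-from-C (3 +ℕ m)) (-‿cong (+-cong (E-from-C (2 +ℕ m)) (-‿cong (E-from-C (suc m)))))) ⟩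
      C (4 +ℕ m) + - C (3 +ℕ m) + - (C (3 +ℕ m) + - C (2 +ℕ m) + - (C (2 +ℕ m) + - C (suc m)))
        + sgn (7 +ℕ m) a * C (4 +ℕ m)
        ≈⟨ collect _ _ _ _ _ ⟩
      C (4 +ℕ m) * (1# + sgn (7 +ℕ m) a) + - (C (3 +ℕ m) + C (3 +ℕ m)) + (C (2 +ℕ m) + C (2 +ℕ m)) + - C (suc m) ∎
      where
      corner-term : sgn (5 +ℕ m) (Tentry (6 +ℕ m) a 0 (5 +ℕ m) * K (5 +ℕ m)) ≈ sgn (7 +ℕ m) a * C (4 +ℕ m)
      corner-term = trans (sgn-*ˡ (5 +ℕ m) _ _)
        (*-cong (trans (sgn-cong (5 +ℕ m) (T-corner m)) (sym (sgn-2+ (5 +ℕ m) a))) (K-from-C (4 +ℕ m)))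

lemma5 : {c ℓ : Level} (R : CommutativeRing c ℓ) →
    let open CommutativeRing R
        open Det R
    in (a : Carrier) (n : ℕ) → 6 ≤ n →
       T n a ≈ C (n ∸ 2) * (1# + sgn (suc n) a) + - (C (n ∸ 3) + C (n ∸ 3)) + (C (n ∸ 4) + C (n ∸ 4)) + - C (n ∸ 5)
lemma5 R a _ (s≤s (s≤s (s≤s (s≤s (s≤s (s≤s (z≤n {m}))))))) = BandDeterminants.CornerMinors.T-formula R a m
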